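{- Let $f:\mathbb{Z}_+\to\mathbb{R}$ be an arithmetic function, let $(x_p)_{p\in\mathbb{P}}$ be a sequence of real numbers and let $(y_p)_{p\in\mathbb{P}}$ be a sequence of nonzero real numbers, both indexed by the set $\mathbb{P}$ of primes. The following conditions are equivalent: (a) $f$ is L-additive with an associated function $h_f$ satisfying $h_f(p)=y_p$ for all $p\in\mathbb{P}$, and $f(p)=x_p$ for all $p\in\mathbb{P}$; (b) for all $n\in\mathbb{Z}_+$, $$f(n)=\Big(\sum_{p\in\mathbb{P}}\nu_p(n)\frac{x_p}{y_p}\Big)\prod_{p\in\mathbb{P}}y_p^{\nu_p(n)}.$$
   Context: For $n\in\mathbb{Z}_+$ and a prime $p$, $\nu_p(n)$ denotes the exponent of $p$ in the prime factorization of $n$, so $n=\prod_{p\in\mathbb{P}}p^{\nu_p(n)}$. An arithmetic function $h:\mathbb{Z}_+\to\mathbb{R}$ is completely multiplicative if $h(1)=1$ and $h(mn)=h(m)h(n)$ for all $m,n\in\mathbb{Z}_+$. An arithmetic function $f$ is L-additive (Leibniz-additive) if there is a nonzero-valued completely multiplicative function $h_f$ such that $f(mn)=f(m)h_f(n)+f(n)h_f(m)$ for all $m,n\in\mathbb{Z}_+$. -}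

module Defs where

open import Level using (suc; _⊔_)
open import Algebra.Bundles using (CommutativeRing)
open import Data.Nat as ℕ using (ℕ; zero; NonZero)
open import Data.Nat.Divisibility using (_∣?_; quotient)
open import Data.Nat.Primality using (Prime; prime?)
open import Relation.Nullary using (¬_; yes; no)

record Field (c ℓ : Level.Level) : Set (Level.suc (c ⊔ ℓ)) where
  field
    commutativeRing : CommutativeRing c ℓ
  open CommutativeRing commutativeRing public
  field
    0≉1    : ¬ (0# ≈ 1#)
    inv    : (x : Carrier) → ¬ (x ≈ 0#) → Carrier
    inv-*  : (x : Carrier) (x≉0 : ¬ (x ≈ 0#)) → x * inv x x≉0 ≈ 1#

-- p-adic valuation ν_p(n): number of times p divides n (fuel = n, which
-- suffices for p ≥ 2, n ≥ 1; only used for primes p and n ≥ 1).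
ν-fuel : ℕ → ℕ → ℕ → ℕ
ν-fuel zero    p n = 0
ν-fuel (ℕ.suc k) p n with p ∣? n
... | yes p∣n = ℕ.suc (ν-fuel k p (quotient p∣n))
... | no  _   = 0

ν : ℕ → ℕ → ℕ
ν p n = ν-fuel n p n

module FieldOps {c ℓ} (F : Field c ℓ) where
  open Field F public

  _·_ : ℕ → Carrier → Carrier
  zero    · a = 0#
  ℕ.suc k · a = a + (k · a)

  _^_ : Carrier → ℕ → Carrier
  a ^ zero    = 1#
  a ^ ℕ.suc k = a * (a ^ k)

  -- Σ_{p prime, p ≤ k} ν_p(n) · (x p / y p)
  -- (primes p > n have ν_p(n) = 0, so taking k = n gives the full sum over ℙ)
  sumP : (x y : ℕ → Carrier) → (∀ p → Prime p → ¬ (y p ≈ 0#)) → ℕ → ℕ → Carrier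
  sumP x y ynz zero      n = 0#
  sumP x y ynz (ℕ.suc k) n with prime? (ℕ.suc k)
  ... | yes pr = sumP x y ynz k n + (ν (ℕ.suc k) n · (x (ℕ.suc k) * inv (y (ℕ.suc k)) (ynz (ℕ.suc k) pr)))
  ... | no  _  = sumP x y ynz k n

  prodP : (y : ℕ → Carrier) → ℕ → ℕ → Carrier
  prodP y zero      n = 1#
  prodP y (ℕ.suc k) n with prime? (ℕ.suc k)
  ... | yes _ = prodP y k n * (y (ℕ.suc k) ^ ν (ℕ.suc k) n)
  ... | no  _ = prodP y k n

  CompletelyMultiplicative : (ℕ → Carrier) → Set ℓ
  CompletelyMultiplicative h =
    (h 1 ≈ 1#) × (∀ m n → NonZero m → NonZero n → h (m ℕ.* n) ≈ h m * h n)
    where open import Data.Product using (_×_)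

  LAdditiveWith : (f h : ℕ → Carrier) → Set ℓ
  LAdditiveWith f h =
    (∀ n → NonZero n → ¬ (h n ≈ 0#)) × CompletelyMultiplicative h ×
    (∀ m n → NonZero m → NonZero n → f (m ℕ.* n) ≈ f m * h n + f n * h m)
    where open import Data.Product using (_×_)

-- Put S(n) = Σ_p ν_p(n) x_p / y_p and P(n) = Π_p y_p ^ ν_p(n). As ν_p(mn) = ν_p(m) + ν_p(n),
-- S is additive and P completely multiplicative, so S · P obeys the Leibniz rule with h = P;
-- moreover P(p) = y_p and S(p) P(p) = x_p, which gives (b) ⇒ (a). Conversely, a completely
-- multiplicative function, and an L-additive function with a given h, are determined by
-- their values at the primes (induct along a prime factorisation), so (a) forces f = S · P.

module Submission where

open import Defs
open import Algebra.Bundles using (CommutativeMonoid)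
open import Data.Nat as ℕ using (ℕ; zero; suc; _≤_; _<_; s≤s; NonZero)
open import Data.Nat.Divisibility using (_∣_; ∣⇒≤)
open import Data.Nat.Primality using (Prime; prime?; prime⇒nonZero; prime⇒nonTrivial)
open import Data.Nat.Properties using (≤-refl; m≤n⇒m≤1+n; m≤n⇒m<n∨m≡n; ≤-pred; <⇒≱; m≤m*n; m≤n*m; m*n≢0)
open import Data.Product using (∃; _,_)
open import Data.Sum using (inj₁; inj₂)
open import Data.Empty using (⊥-elim)
open import Function.Bundles using (_⇔_; mk⇔)
open import Relation.Nullary using (¬_; yes; no)
open import Relation.Binary.PropositionalEquality as ≡ using (_≡_)

module Arithmetic where

  open import Data.Nat using (_+_; _*_; _^_; z≤n; NonTrivial; nonTrivial⇒nonZero; nonTrivial⇒n>1; nonTrivial⇒≢1)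
  open import Data.Nat.Properties
  open import Data.Nat.Divisibility
  open import Data.Nat.Primality
  open import Data.Nat.Primality.Factorisation using (factorise; PrimeFactorisation)
  open import Data.Nat.Induction using (<-wellFounded)
  open import Data.Nat.ListAction using (product)
  open import Data.List.Relation.Unary.All using (All; []; _∷_)
  open import Data.Sum using ([_,_])
  open import Induction.WellFounded using (Acc; acc)
  open import Relation.Binary.PropositionalEquality using (_≡_; refl; sym; trans; cong; cong₂; subst; module ≡-Reasoning)
  open import Algebra.Properties.CommutativeSemigroup *-commutativeSemigroup using (interchange)

  n<m^n : ∀ {m} → 1 < m → ∀ n → n < m ^ n
  n<m^n 1<m zero = s≤s z≤n
  n<m^n {m@(suc _)} 1<m (suc n) = begin-strict
    suc n      ≤⟨ n<m^n 1<m n ⟩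
    m ^ n      <⟨ m<m*n (m ^ n) m 1<m ⟩
    m ^ n * m  ≡⟨ *-comm (m ^ n) m ⟩
    m ^ suc n  ∎
    where open ≤-Reasoning
          instance _ = m^n≢0 m n

  module _ {p : ℕ} .{{_ : NonTrivial p}} where

    private instance _ = nonTrivial⇒nonZero p

    ν-fuel-∤ : ∀ k {n} → ¬ p ∣ n → ν-fuel k p n ≡ 0
    ν-fuel-∤ zero    p∤n = refl
    ν-fuel-∤ (suc k) {n} p∤n with p ∣? n
    ... | yes p∣n = ⊥-elim (p∤n p∣n)
    ... | no  _   = refl

    ν-fuel-p* : ∀ k n → ν-fuel (suc k) p (p * n) ≡ suc (ν-fuel k p n)
    ν-fuel-p* k n with p ∣? p * n
    ... | yes p∣pn = cong (λ q → suc (ν-fuel k p q)) (*-cancelˡ-≡ _ _ p (sym (m∣n⇒n≡m*quotient p∣pn)))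
    ... | no  p∤pn = ⊥-elim (p∤pn (m∣m*n n))

    ν-fuel-p^a* : ∀ {r} → ¬ p ∣ r → ∀ {k} a → a ≤ k → ν-fuel k p (p ^ a * r) ≡ a
    ν-fuel-p^a* {r} p∤r {k} zero _ = subst (λ n → ν-fuel k p n ≡ 0) (sym (*-identityˡ r)) (ν-fuel-∤ k p∤r)
    ν-fuel-p^a* {r} p∤r {suc k} (suc a) (s≤s a≤k) = begin
      ν-fuel (suc k) p (p * p ^ a * r)    ≡⟨ cong (ν-fuel (suc k) p) (*-assoc p (p ^ a) r) ⟩
      ν-fuel (suc k) p (p * (p ^ a * r))  ≡⟨ ν-fuel-p* k (p ^ a * r) ⟩
      suc (ν-fuel k p (p ^ a * r))        ≡⟨ cong suc (ν-fuel-p^a* p∤r a a≤k) ⟩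
      suc a                               ∎
      where open ≡-Reasoning

    ν-p^a* : ∀ {r} → ¬ p ∣ r → ∀ a → ν p (p ^ a * r) ≡ a
    ν-p^a* {zero}  p∤r a = ⊥-elim (p∤r (p ∣0))
    ν-p^a* {suc r} p∤r a = ν-fuel-p^a* p∤r a
      (≤-trans (<⇒≤ (n<m^n (nonTrivial⇒n>1 p) a)) (m≤m*n (p ^ a) (suc r)))

    ν-∤ : ∀ {n} → ¬ p ∣ n → ν p n ≡ 0
    ν-∤ {n} p∤n = ν-fuel-∤ n p∤n

    ν-self : ν p p ≡ 1
    ν-self = subst (λ n → ν p n ≡ 1) (trans (*-identityʳ (p ^ 1)) (*-identityʳ p))
      (ν-p^a* (λ p∣1 → nonTrivial⇒≢1 {p} (∣1⇒≡1 p∣1)) 1)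

    record PrimePowerSplit (n : ℕ) : Set where
      constructor split
      field
        exponent cofactor : ℕ
        p∤cofactor : ¬ p ∣ cofactor
        n≡p^exponent*cofactor : n ≡ p ^ exponent * cofactor

    splitPrimePower : ∀ n .{{_ : NonZero n}} → PrimePowerSplit n
    splitPrimePower n = go n (<-wellFounded n)
      where
      go : ∀ n → Acc _<_ n → .{{NonZero n}} → PrimePowerSplit n
      go n (acc rec) with p ∣? n
      ... | no p∤n = split 0 n p∤n (sym (*-identityˡ n))
      ... | yes p∣n with go (quotient p∣n) (rec (quotient-< p∣n)) {{quotient≢0 p∣n}}
      ...   | split a r p∤r q≡p^a*r = split (suc a) r p∤r (begin
        n                ≡⟨ m∣n⇒n≡m*quotient p∣n ⟩
        p * quotient p∣n ≡⟨ cong (p *_) q≡p^a*r ⟩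
        p * (p ^ a * r)  ≡⟨ *-assoc p (p ^ a) r ⟨
        p ^ suc a * r    ∎)
        where open ≡-Reasoning

  ν-* : ∀ {p} → Prime p → ∀ m n .{{_ : NonZero m}} .{{_ : NonZero n}} → ν p (m * n) ≡ ν p m + ν p n
  ν-* {p} pp m n
    with split a r p∤r refl ← splitPrimePower m | split b s p∤s refl ← splitPrimePower n = begin
      ν p (p ^ a * r * (p ^ b * s))     ≡⟨ cong (ν p) (interchange (p ^ a) r (p ^ b) s) ⟩
      ν p (p ^ a * p ^ b * (r * s))     ≡⟨ cong (λ q → ν p (q * (r * s))) (^-distribˡ-+-* p a b) ⟨
      ν p (p ^ (a + b) * (r * s))       ≡⟨ ν-p^a* p∤rs (a + b) ⟩
      a + b                             ≡⟨ cong₂ _+_ (ν-p^a* p∤r a) (ν-p^a* p∤s b) ⟨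
      ν p (p ^ a * r) + ν p (p ^ b * s) ∎
    where
    open ≡-Reasoning
    instance _ = prime⇒nonTrivial pp
    p∤rs : ¬ p ∣ r * s
    p∤rs p∣rs = [ p∤r , p∤s ] (euclidsLemma r s pp p∣rs)

  prime∤1 : ∀ {p} → Prime p → ¬ p ∣ 1
  prime∤1 pp p∣1 = nonTrivial⇒≢1 {{prime⇒nonTrivial pp}} (∣1⇒≡1 p∣1)

  nonTrivial<prime⇒∤ : ∀ {p q} .{{_ : NonTrivial q}} → Prime p → q < p → ¬ q ∣ p
  nonTrivial<prime⇒∤ pp q<p q∣p = Prime.notComposite pp (composite q<p q∣p)

  prime-induction : ∀ {ℓ} (Q : ℕ → Set ℓ) → Q 1 → (∀ {p m} → Prime p → NonZero m → Q m → Q (p * m)) →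
                    ∀ n → NonZero n → Q n
  prime-induction Q Q1 Q-step n n≢0 = subst Q (sym isFactorisation) (Q-product factorsPrime)
    where
    open PrimeFactorisation (factorise n {{n≢0}})
    Q-product : ∀ {ps} → All Prime ps → Q (product ps)
    Q-product []        = Q1
    Q-product (pp ∷ ps) = Q-step pp (productOfPrimes≢0 ps) (Q-product ps)

open Arithmetic

module PrimeProducts {c ℓ} (M : CommutativeMonoid c ℓ) where

  open CommutativeMonoid M
  open import Algebra.Properties.CommutativeSemigroup commutativeSemigroup using (interchange)
  open import Algebra.Definitions.RawMonoid rawMonoid using (_×_) public
  open import Algebra.Properties.Monoid.Mult monoid using (×-congˡ; ×-homo-1; ×-homo-+)

  -- Terms may depend on the primality proof, as x p / y p does through inv;
  -- this is why ∏-primes≤-prime only recovers the term at some proof of primality.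
  ∏-primes≤ : ((p : ℕ) → Prime p → Carrier) → ℕ → Carrier
  ∏-primes≤ g zero = ε
  ∏-primes≤ g (suc K) with prime? (suc K)
  ... | yes pr = ∏-primes≤ g K ∙ g (suc K) pr
  ... | no  _  = ∏-primes≤ g K

  module _ {g h : (p : ℕ) → Prime p → Carrier} where

    ∏-primes≤-cong : (∀ p pr → g p pr ≈ h p pr) → ∀ K → ∏-primes≤ g K ≈ ∏-primes≤ h K
    ∏-primes≤-cong g≈h zero = refl
    ∏-primes≤-cong g≈h (suc K) with prime? (suc K)
    ... | yes pr = ∙-cong (∏-primes≤-cong g≈h K) (g≈h (suc K) pr)
    ... | no  _  = ∏-primes≤-cong g≈h K

    ∏-primes≤-∙ : ∀ K → ∏-primes≤ (λ p pr → g p pr ∙ h p pr) K ≈ ∏-primes≤ g K ∙ ∏-primes≤ h K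
    ∏-primes≤-∙ zero = sym (identityˡ ε)
    ∏-primes≤-∙ (suc K) with prime? (suc K)
    ... | yes pr = trans (∙-congʳ (∏-primes≤-∙ K)) (interchange _ _ _ _)
    ... | no  _  = ∏-primes≤-∙ K

  module _ {g : (p : ℕ) → Prime p → Carrier} where

    ∏-primes≤-ε : ∀ K → (∀ p pr → p ≤ K → g p pr ≈ ε) → ∏-primes≤ g K ≈ ε
    ∏-primes≤-ε zero    _   = refl
    ∏-primes≤-ε (suc K) g≈ε with prime? (suc K)
    ... | yes pr = trans (∙-cong (∏-primes≤-ε K g≈ε′) (g≈ε (suc K) pr ≤-refl)) (identityˡ ε)
      where g≈ε′ = λ p pr p≤K → g≈ε p pr (m≤n⇒m≤1+n p≤K)
    ... | no  _  = ∏-primes≤-ε K (λ p pr p≤K → g≈ε p pr (m≤n⇒m≤1+n p≤K))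

    ∏-primes≤-stable : ∀ {n} K → n ≤ K → (∀ p pr → n < p → g p pr ≈ ε) →
                       ∏-primes≤ g K ≈ ∏-primes≤ g n
    ∏-primes≤-stable zero ℕ.z≤n g≈ε = refl
    ∏-primes≤-stable (suc K) n≤1+K g≈ε with m≤n⇒m<n∨m≡n n≤1+K
    ... | inj₂ ≡.refl = refl
    ... | inj₁ n<1+K with prime? (suc K)
    ...   | yes pr = trans (∙-cong (∏-primes≤-stable K (≤-pred n<1+K) g≈ε) (g≈ε (suc K) pr n<1+K)) (identityʳ _)
    ...   | no  _  = ∏-primes≤-stable K (≤-pred n<1+K) g≈ε

    ∏-primes≤-prime : ∀ {p} → Prime p → (∀ q pr → q < p → g q pr ≈ ε) →
                      ∃ λ pr → ∏-primes≤ g p ≈ g p pr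
    ∏-primes≤-prime {suc p} pp g≈ε with prime? (suc p)
    ... | yes pr = pr , trans (∙-congʳ (∏-primes≤-ε p (λ q pr q≤p → g≈ε q pr (s≤s q≤p)))) (identityˡ _)
    ... | no ¬pp = ⊥-elim (¬pp pp)

  module _ (c : (p : ℕ) → Prime p → Carrier) where

    -- ∏ν≤ K n is Π_{p ≤ K} c_p ^ ν_p(n) written in M: sumP and prodP are its
    -- instances in the additive and the multiplicative monoid of the field.
    ∏ν≤ : ℕ → ℕ → Carrier
    ∏ν≤ K n = ∏-primes≤ (λ p pr → ν p n × c p pr) K

    ∏ν : ℕ → Carrier
    ∏ν n = ∏ν≤ n n

    ∤⇒ν×≈ε : ∀ {p n} pr → ¬ p ∣ n → ν p n × c p pr ≈ ε
    ∤⇒ν×≈ε pr p∤n = ×-congˡ (ν-∤ {{prime⇒nonTrivial pr}} p∤n)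

    ∏ν≤-* : ∀ K m n .{{_ : NonZero m}} .{{_ : NonZero n}} → ∏ν≤ K (m ℕ.* n) ≈ ∏ν≤ K m ∙ ∏ν≤ K n
    ∏ν≤-* K m n = trans
      (∏-primes≤-cong (λ p pr → trans (×-congˡ (ν-* pr m n)) (×-homo-+ (c p pr) (ν p m) (ν p n))) K)
      (∏-primes≤-∙ K)

    ∏ν≤-stable : ∀ K n .{{_ : NonZero n}} → n ≤ K → ∏ν≤ K n ≈ ∏ν n
    ∏ν≤-stable K n n≤K = ∏-primes≤-stable K n≤K
      (λ p pr n<p → ∤⇒ν×≈ε pr (λ p∣n → <⇒≱ n<p (∣⇒≤ p∣n)))

    ∏ν-* : ∀ m n .{{_ : NonZero m}} .{{_ : NonZero n}} → ∏ν (m ℕ.* n) ≈ ∏ν m ∙ ∏ν n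
    ∏ν-* m n = trans (∏ν≤-* (m ℕ.* n) m n)
      (∙-cong (∏ν≤-stable _ m (m≤m*n m n)) (∏ν≤-stable _ n (m≤n*m n m)))

    ∏ν-1 : ∏ν 1 ≈ ε
    ∏ν-1 = ∏-primes≤-ε 1 (λ p pr _ → ∤⇒ν×≈ε pr (prime∤1 pr))

    ∏ν-prime : ∀ {p} → Prime p → ∃ λ pr → ∏ν p ≈ c p pr
    ∏ν-prime {p} pp
      with ∏-primes≤-prime pp (λ q pq q<p → ∤⇒ν×≈ε pq (nonTrivial<prime⇒∤ {{prime⇒nonTrivial pq}} pp q<p))
    ... | pr , ∏≈ν = pr , trans ∏≈ν (trans (×-congˡ (ν-self {{prime⇒nonTrivial pp}})) (×-homo-1 (c p pr)))

    ∏ν-closed : ∀ {q} (Q : Carrier → Set q) → Q ε → (∀ {a b} → Q a → Q b → Q (a ∙ b)) →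
                (∀ p pr → Q (c p pr)) → ∀ n → Q (∏ν n)
    ∏ν-closed Q Qε Q∙ Qc n = ∏-closed n
      where
      ×-closed : ∀ k {a} → Q a → Q (k × a)
      ×-closed zero    Qa = Qε
      ×-closed (suc k) Qa = Q∙ Qa (×-closed k Qa)
      ∏-closed : ∀ K → Q (∏ν≤ K n)
      ∏-closed zero = Qε
      ∏-closed (suc K) with prime? (suc K)
      ... | yes pr = Q∙ (∏-closed K) (×-closed (ν (suc K) n) (Qc (suc K) pr))
      ... | no  _  = ∏-closed K

module FieldFacts {c ℓ} (F : Field c ℓ) where

  open FieldOps F
  open import Algebra.Properties.Group +-group using (identityˡ-unique)
  open import Relation.Binary.Reasoning.Setoid setoid
  module Additive = PrimeProducts +-commutativeMonoid
  module Multiplicative = PrimeProducts *-commutativeMonoid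

  ·≡× : ∀ k a → k · a ≡ k Additive.× a
  ·≡× zero    a = ≡.refl
  ·≡× (suc k) a = ≡.cong (a +_) (·≡× k a)

  ^≡× : ∀ a k → a ^ k ≡ k Multiplicative.× a
  ^≡× a zero    = ≡.refl
  ^≡× a (suc k) = ≡.cong (a *_) (^≡× a k)

  *-≉0 : ∀ {a b} → ¬ a ≈ 0# → ¬ b ≈ 0# → ¬ a * b ≈ 0#
  *-≉0 {a} {b} a≉0 b≉0 ab≈0 = b≉0 (begin
    b                   ≈⟨ *-identityˡ b ⟨
    1# * b              ≈⟨ *-congʳ (trans (*-comm _ a) (inv-* a a≉0)) ⟨
    inv a a≉0 * a * b   ≈⟨ *-assoc _ a b ⟩
    inv a a≉0 * (a * b) ≈⟨ *-congˡ ab≈0 ⟩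
    inv a a≉0 * 0#      ≈⟨ zeroʳ _ ⟩
    0#                  ∎)

  module _ {f h : ℕ → Carrier} where

    lAdditive⇒f1≈0 : LAdditiveWith f h → f 1 ≈ 0#
    lAdditive⇒f1≈0 (_ , (h1≈1 , _) , f-leibniz) = identityˡ-unique (f 1) (f 1) (begin
      f 1 + f 1             ≈⟨ +-cong (*-identityʳ (f 1)) (*-identityʳ (f 1)) ⟨
      f 1 * 1# + f 1 * 1#   ≈⟨ +-cong (*-congˡ h1≈1) (*-congˡ h1≈1) ⟨
      f 1 * h 1 + f 1 * h 1 ≈⟨ f-leibniz 1 1 _ _ ⟨
      f 1                   ∎)

    lAdditive-resp : ∀ {g} → LAdditiveWith g h → (∀ n → NonZero n → f n ≈ g n) → LAdditiveWith f h
    lAdditive-resp {g} (h≉0 , h-mult , g-leibniz) f≈g = h≉0 , h-mult , λ m n m≢0 n≢0 → begin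
      f (m ℕ.* n)           ≈⟨ f≈g (m ℕ.* n) (m*n≢0 m n {{m≢0}} {{n≢0}}) ⟩
      g (m ℕ.* n)           ≈⟨ g-leibniz m n m≢0 n≢0 ⟩
      g m * h n + g n * h m ≈⟨ +-cong (*-congʳ (f≈g m m≢0)) (*-congʳ (f≈g n n≢0)) ⟨
      f m * h n + f n * h m ∎

  completelyMultiplicative-unique : ∀ {h h′} → CompletelyMultiplicative h → CompletelyMultiplicative h′ →
    (∀ p → Prime p → h p ≈ h′ p) → ∀ n → NonZero n → h n ≈ h′ n
  completelyMultiplicative-unique {h} {h′} (h1≈1 , h-*) (h′1≈1 , h′-*) h≈h′ =
    prime-induction (λ n → h n ≈ h′ n) (trans h1≈1 (sym h′1≈1)) λ {p} {m} pp m≢0 hm≈h′m → begin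
      h (p ℕ.* m)   ≈⟨ h-* p m (prime⇒nonZero pp) m≢0 ⟩
      h p * h m     ≈⟨ *-cong (h≈h′ p pp) hm≈h′m ⟩
      h′ p * h′ m   ≈⟨ h′-* p m (prime⇒nonZero pp) m≢0 ⟨
      h′ (p ℕ.* m)  ∎

  lAdditive-unique : ∀ {f g h h′} → LAdditiveWith f h → LAdditiveWith g h′ →
    (∀ n → NonZero n → h n ≈ h′ n) → (∀ p → Prime p → f p ≈ g p) → ∀ n → NonZero n → f n ≈ g n
  lAdditive-unique {f} {g} {h} {h′} f-add@(_ , _ , f-leibniz) g-add@(_ , _ , g-leibniz) h≈h′ f≈g =
    prime-induction (λ n → f n ≈ g n) (trans (lAdditive⇒f1≈0 f-add) (sym (lAdditive⇒f1≈0 g-add)))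
      λ {p} {m} pp m≢0 fm≈gm → begin
        f (p ℕ.* m)             ≈⟨ f-leibniz p m (prime⇒nonZero pp) m≢0 ⟩
        f p * h m + f m * h p   ≈⟨ +-cong (*-cong (f≈g p pp) (h≈h′ m m≢0))
                                          (*-cong fm≈gm (h≈h′ p (prime⇒nonZero pp))) ⟩
        g p * h′ m + g m * h′ p ≈⟨ g-leibniz p m (prime⇒nonZero pp) m≢0 ⟨
        g (p ℕ.* m)             ∎

  module Formula (x y : ℕ → Carrier) (y≉0 : ∀ p → Prime p → ¬ y p ≈ 0#) where

    x/y y′ : (p : ℕ) → Prime p → Carrier
    x/y p pr = x p * inv (y p) (y≉0 p pr)
    y′ p _ = y p

    S P formula : ℕ → Carrier
    S = Additive.∏ν x/y
    P = Multiplicative.∏ν y′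
    formula n = S n * P n

    sumP≡∏ν≤ : ∀ K n → sumP x y y≉0 K n ≡ Additive.∏ν≤ x/y K n
    sumP≡∏ν≤ zero    n = ≡.refl
    sumP≡∏ν≤ (suc K) n with prime? (suc K)
    ... | yes pr = ≡.cong₂ _+_ (sumP≡∏ν≤ K n) (·≡× (ν (suc K) n) (x/y (suc K) pr))
    ... | no  _  = sumP≡∏ν≤ K n

    prodP≡∏ν≤ : ∀ K n → prodP y K n ≡ Multiplicative.∏ν≤ y′ K n
    prodP≡∏ν≤ zero    n = ≡.refl
    prodP≡∏ν≤ (suc K) n with prime? (suc K)
    ... | yes _ = ≡.cong₂ _*_ (prodP≡∏ν≤ K n) (^≡× (y (suc K)) (ν (suc K) n))
    ... | no  _ = prodP≡∏ν≤ K n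

    sumP*prodP≡formula : ∀ n → sumP x y y≉0 n n * prodP y n n ≡ formula n
    sumP*prodP≡formula n = ≡.cong₂ _*_ (sumP≡∏ν≤ n n) (prodP≡∏ν≤ n n)

    P-prime : ∀ p → Prime p → P p ≈ y p
    P-prime p pp with Multiplicative.∏ν-prime y′ pp
    ... | _ , Pp≈yp = Pp≈yp

    formula-prime : ∀ p → Prime p → formula p ≈ x p
    formula-prime p pp with Additive.∏ν-prime x/y pp
    ... | pr , Sp≈x/y = begin
      S p * P p                          ≈⟨ *-cong Sp≈x/y (P-prime p pp) ⟩
      x p * inv (y p) (y≉0 p pr) * y p   ≈⟨ *-assoc (x p) _ (y p) ⟩
      x p * (inv (y p) (y≉0 p pr) * y p) ≈⟨ *-congˡ (trans (*-comm _ (y p)) (inv-* (y p) (y≉0 p pr))) ⟩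
      x p * 1#                           ≈⟨ *-identityʳ (x p) ⟩
      x p                                ∎

    P-completelyMultiplicative : CompletelyMultiplicative P
    P-completelyMultiplicative =
      Multiplicative.∏ν-1 y′ , λ m n m≢0 n≢0 → Multiplicative.∏ν-* y′ m n {{m≢0}} {{n≢0}}

    P≉0 : ∀ n → NonZero n → ¬ P n ≈ 0#
    P≉0 n _ = Multiplicative.∏ν-closed y′ (λ a → ¬ a ≈ 0#) (λ 1≈0 → 0≉1 (sym 1≈0)) *-≉0 y≉0 n

    formula-lAdditive : LAdditiveWith formula P
    formula-lAdditive = P≉0 , P-completelyMultiplicative , λ m n m≢0 n≢0 → begin
      S (m ℕ.* n) * P (m ℕ.* n)             ≈⟨ *-cong (Additive.∏ν-* x/y m n {{m≢0}} {{n≢0}})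
                                                       (Multiplicative.∏ν-* y′ m n {{m≢0}} {{n≢0}}) ⟩
      (S m + S n) * (P m * P n)             ≈⟨ distribʳ (P m * P n) (S m) (S n) ⟩
      S m * (P m * P n) + S n * (P m * P n) ≈⟨ +-cong (*-assoc (S m) (P m) (P n)) (*-congˡ (*-comm (P n) (P m))) ⟨
      S m * P m * P n + S n * (P n * P m)   ≈⟨ +-congˡ (*-assoc (S n) (P n) (P m)) ⟨
      formula m * P n + formula n * P m     ∎

    lAdditive⇒≈formula : ∀ {f h} → LAdditiveWith f h → (∀ p → Prime p → h p ≈ y p) →
                         (∀ p → Prime p → f p ≈ x p) → ∀ n → NonZero n → f n ≈ formula n
    lAdditive⇒≈formula f-add@(_ , h-mult , _) h≈y f≈x =
      lAdditive-unique f-add formula-lAdditive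
        (completelyMultiplicative-unique h-mult P-completelyMultiplicative
          λ p pp → trans (h≈y p pp) (sym (P-prime p pp)))
        (λ p pp → trans (f≈x p pp) (sym (formula-prime p pp)))

open import Data.Product using (Σ; _×_)

theorem3 : ∀ {c ℓ} (F : Field c ℓ) → let open FieldOps F in
    (f : ℕ → Carrier) (x y : ℕ → Carrier) (ynz : ∀ p → Prime p → ¬ (y p ≈ 0#)) →
    (Σ (ℕ → Carrier) (λ h → LAdditiveWith f h × (∀ p → Prime p → h p ≈ y p))
    × (∀ p → Prime p → f p ≈ x p))
    ⇔ (∀ n → NonZero n → f n ≈ sumP x y ynz n n * prodP y n n)
theorem3 F f x y ynz = mk⇔
  (λ { ((_ , f-add , h≈y) , f≈x) n n≢0 →
         trans (lAdditive⇒≈formula f-add h≈y f≈x n n≢0) (reflexive (≡.sym (sumP*prodP≡formula n))) })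
  (λ f≈sumP*prodP →
    let f≈formula = λ n n≢0 → trans (f≈sumP*prodP n n≢0) (reflexive (sumP*prodP≡formula n)) in
    (P , lAdditive-resp formula-lAdditive f≈formula , P-prime) ,
    λ p pp → trans (f≈formula p (prime⇒nonZero pp)) (formula-prime p pp))
  where
  open FieldOps F
  open FieldFacts F
  open Formula x y ynz
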